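{- Let $\pi\in S_n$ contain exactly $r$ occurrences of the pattern $132$. Then the size of the kernel of $\pi$ is at most $2r+1$.
   Context: Patterns. An occurrence of $132$ in $\pi\in S_n$ is a triple of positions $i<j<k$ with $\pi(i)<\pi(k)<\pi(j)$. The graph $G_\pi$. $G_\pi$ is the bipartite graph with vertex classes $V_1$ and $V_3$. The class $V_1$ is the set of entries of $\pi$, and $V_3$ is the set of occurrences of $132$ in $\pi$. An entry is adjacent to an occurrence exactly when it is one of the three entries of that occurrence. Kernel. The kernel of $\pi$ is the subsequence of $\pi$ formed by the entries lying in the connected component of $G_\pi$ containing the entry $n$. Its size is the number of entries in this subsequence. -}

module Defs where

open import Data.Nat using (ℕ; suc)
open import Data.Fin using (Fin; _<_; _<?_; fromℕ)
open import Data.Product using (Σ; _×_; _,_; proj₁; proj₂)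
open import Data.List using (List; length; filter; cartesianProduct; allFin)
open import Relation.Binary.PropositionalEquality using (_≡_)
open import Relation.Nullary using (Dec)
open import Relation.Nullary.Decidable using (_×-dec_)
open import Data.Sum using (_⊎_)

-- A permutation is an injective map Fin n → Fin n (position ↦ value).

Triple : ℕ → Set
Triple n = Fin n × Fin n × Fin n

Is132 : ∀ {n} → (Fin n → Fin n) → Triple n → Set
Is132 π (i , j , k) = (i < j × j < k) × (π i < π k × π k < π j)

is132? : ∀ {n} (π : Fin n → Fin n) (t : Triple n) → Dec (Is132 π t)
is132? π (i , j , k) = ((i <? j) ×-dec (j <? k)) ×-dec ((π i <? π k) ×-dec (π k <? π j))

allTriples : (n : ℕ) → List (Triple n)
allTriples n = cartesianProduct (allFin n) (cartesianProduct (allFin n) (allFin n))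

occ132 : ∀ {n} → (Fin n → Fin n) → ℕ
occ132 {n} π = length (filter (is132? π) (allTriples n))

Occ : ∀ {n} → (Fin n → Fin n) → Set
Occ {n} π = Σ (Triple n) (Is132 π)

_∈Occ_ : ∀ {n} {π : Fin n → Fin n} → Fin n → Occ π → Set
_∈Occ_ {π = π} v ((i , j , k) , _) = v ≡ π i ⊎ v ≡ π j ⊎ v ≡ π k

-- Entries v, w lie in the same connected component of G_π:
-- a walk v – o₁ – v₁ – o₂ – … – w in the bipartite graph.
data Conn {n} (π : Fin n → Fin n) : Fin n → Fin n → Set where
  here : ∀ {v} → Conn π v v
  step : ∀ {v w u} (o : Occ π) → v ∈Occ o → w ∈Occ o → Conn π w u → Conn π v u

-- the kernel of π ∈ S_(suc m): entries in the component of the entry n (= fromℕ m)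
InKernel : ∀ {m} → (Fin (suc m) → Fin (suc m)) → Fin (suc m) → Set
InKernel {m} π v = Conn π v (fromℕ m)

-- Regard each occurrence of 132 as a hyperedge on its three entries. Starting from {n}, repeatedly
-- take an occurrence that meets the current set and add its other two entries. This adds at most
-- 2 entries per occurrence, hence at most 2r in total, and stops at a set closed under all
-- occurrences; such a set contains the whole component of n.
module Submission where

open import Defs
open import Data.Nat using (ℕ; zero; suc; _+_; _*_; _≤_)
open import Data.Nat.Properties using (suc-injective; m≤m+n; +-comm; module ≤-Reasoning)
open import Data.Nat.Tactic.RingSolver using (solve-∀)
open import Data.Fin using (Fin; fromℕ; zero; suc)
import Data.Fin.Properties as Fin
open import Data.List using (List; []; _∷_; length; lookup; map; filter)
open import Data.List.Properties using (length-removeAt′; length-map)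
open import Data.List.Membership.Propositional using (_∈_)
open import Data.List.Membership.Propositional.Properties
  using (∈-lookup; ∈-map⁺; ∈-filter⁺; ∈-cartesianProduct⁺; ∈-allFin)
open import Data.List.Relation.Binary.Subset.Propositional using (_⊆_)
open import Data.List.Relation.Unary.All using (All)
import Data.List.Relation.Unary.All as All
open import Data.List.Relation.Unary.All.Properties using (¬Any⇒All¬; ─⁻)
open import Data.List.Relation.Unary.Any as Any using (Any; here; there; any?; _─_)
open import Data.List.Relation.Unary.Any.Properties using (lookup-index; lookup-result)
open import Data.List.Relation.Unary.AllPairs using (_∷_)
open import Data.List.Relation.Unary.Unique.Propositional using (Unique)
open import Data.Product using (_×_; _,_; Σ-syntax)
open import Data.Sum using (_⊎_; inj₁; inj₂)
open import Data.Empty using (⊥-elim)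
open import Function using (_∘_)
open import Function.Definitions using (Injective)
open import Relation.Binary.Definitions using (DecidableEquality)
open import Relation.Binary.PropositionalEquality using (_≡_; refl; sym; trans; cong)
open import Relation.Nullary using (Dec; yes; no)
open import Relation.Nullary.Decidable using (_⊎-dec_)

module _ {a} {A : Set a} where

  lookup-injective : ∀ {xs : List A} → Unique xs → Injective _≡_ _≡_ (lookup xs)
  lookup-injective (_ ∷ _)      {zero}  {zero}  _  = refl
  lookup-injective (x∉xs ∷ _)   {zero}  {suc j} eq = ⊥-elim (All.lookup x∉xs (∈-lookup j) eq)
  lookup-injective (x∉xs ∷ _)   {suc i} {zero}  eq = ⊥-elim (All.lookup x∉xs (∈-lookup i) (sym eq))
  lookup-injective (_ ∷ unique) {suc i} {suc j} eq = cong suc (lookup-injective unique eq)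

  Unique-⊆⇒length≤ : ∀ {xs ys : List A} → Unique xs → xs ⊆ ys → length xs ≤ length ys
  Unique-⊆⇒length≤ {xs} {ys} unique xs⊆ys = Fin.injective⇒≤ position-injective
    where
      position : Fin (length xs) → Fin (length ys)
      position i = Any.index (xs⊆ys (∈-lookup i))

      lookup-position : ∀ i → lookup xs i ≡ lookup ys (position i)
      lookup-position i = lookup-index (xs⊆ys (∈-lookup i))

      position-injective : Injective _≡_ _≡_ position
      position-injective {i} {j} eq = lookup-injective unique
        (trans (lookup-position i) (trans (cong (lookup ys) eq) (sym (lookup-position j))))

module Hypergraph {a} {A : Set a} (_≟_ : DecidableEquality A) where

  open import Data.List.Membership.DecPropositional _≟_ using (_∈?_)

  Edge : Set a
  Edge = A × A × A

  _∈ₑ_ : A → Edge → Set a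
  v ∈ₑ (x , y , z) = v ≡ x ⊎ v ≡ y ⊎ v ≡ z

  Meets : List A → Edge → Set a
  Meets S (x , y , z) = x ∈ S ⊎ y ∈ S ⊎ z ∈ S

  meets? : ∀ S e → Dec (Meets S e)
  meets? S (x , y , z) = (x ∈? S) ⊎-dec ((y ∈? S) ⊎-dec (z ∈? S))

  ∈ₑ-meets : ∀ {S v} e → v ∈ₑ e → v ∈ S → Meets S e
  ∈ₑ-meets _ (inj₁ refl)        v∈S = inj₁ v∈S
  ∈ₑ-meets _ (inj₂ (inj₁ refl)) v∈S = inj₂ (inj₁ v∈S)
  ∈ₑ-meets _ (inj₂ (inj₂ refl)) v∈S = inj₂ (inj₂ v∈S)

  _⊆ₑ_ : Edge → List A → Set a
  e ⊆ₑ S = ∀ {v} → v ∈ₑ e → v ∈ S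

  ClosedUnder : List A → Edge → Set a
  ClosedUnder S e = Meets S e → e ⊆ₑ S

  absorb : ∀ {S} e → Meets S e → Σ[ x ∈ A ] Σ[ y ∈ A ] e ⊆ₑ (x ∷ y ∷ S)
  absorb (x , y , z) (inj₁ x∈S) = y , z , λ
    { (inj₁ refl) → there (there x∈S) ; (inj₂ (inj₁ refl)) → here refl ; (inj₂ (inj₂ refl)) → there (here refl) }
  absorb (x , y , z) (inj₂ (inj₁ y∈S)) = x , z , λ
    { (inj₁ refl) → here refl ; (inj₂ (inj₁ refl)) → there (there y∈S) ; (inj₂ (inj₂ refl)) → there (here refl) }
  absorb (x , y , z) (inj₂ (inj₂ z∈S)) = x , y , λ
    { (inj₁ refl) → here refl ; (inj₂ (inj₁ refl)) → there (here refl) ; (inj₂ (inj₂ refl)) → there (there z∈S) }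

  record Closure (S : List A) (R : List Edge) : Set a where
    field
      carrier : List A
      extends : S ⊆ carrier
      size    : length carrier ≤ length S + 2 * length R
      closed  : All (ClosedUnder carrier) R

  private
    two-more : ∀ s l → 2 + s + 2 * l ≡ s + 2 * suc l
    two-more = solve-∀

    closure′ : ∀ k S R → length R ≡ k → Closure S R
    closure′ _ S R _ with any? (meets? S) R
    closure′ _ S R _ | no ¬meets = record
      { carrier = S
      ; extends = λ v∈S → v∈S
      ; size    = m≤m+n _ _
      ; closed  = All.map (λ ¬meets-e meets-e → ⊥-elim (¬meets-e meets-e)) (¬Any⇒All¬ R ¬meets)
      }
    closure′ zero    S (_ ∷ _) () | yes _
    closure′ (suc k) S R       eq | yes meets with absorb (Any.lookup meets) (lookup-result meets)
    ... | x , y , e⊆ = record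
      { carrier = carrier
      ; extends = λ v∈S → extends (there (there v∈S))
      ; size    = begin
          length carrier                           ≤⟨ size ⟩
          2 + length S + 2 * length (R ─ meets)    ≡⟨ two-more (length S) _ ⟩
          length S + 2 * suc (length (R ─ meets))  ≡⟨ cong (λ l → length S + 2 * l) length-R ⟨
          length S + 2 * length R                  ∎
      ; closed  = ─⁻ meets (λ _ → extends ∘ e⊆) closed
      }
      where
        length-R : length R ≡ suc (length (R ─ meets))
        length-R = length-removeAt′ R (Any.index meets)
        open Closure (closure′ k (x ∷ y ∷ S) (R ─ meets) (suc-injective (trans (sym length-R) eq)))
        open ≤-Reasoning

  closure : ∀ S R → Closure S R
  closure S R = closure′ (length R) S R refl

module _ {n : ℕ} (π : Fin n → Fin n) where

  open Hypergraph (Fin._≟_ {n})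

  entries : Triple n → Edge
  entries (i , j , k) = π i , π j , π k

  occurrence-edges : List Edge
  occurrence-edges = map entries (filter (is132? π) (allTriples n))

  length-occurrence-edges : length occurrence-edges ≡ occ132 π
  length-occurrence-edges = length-map entries (filter (is132? π) (allTriples n))

  occurrence∈edges : ∀ {t} → Is132 π t → entries t ∈ occurrence-edges
  occurrence∈edges {i , j , k} occ = ∈-map⁺ entries
    (∈-filter⁺ (is132? π) (∈-cartesianProduct⁺ (∈-allFin i) (∈-cartesianProduct⁺ (∈-allFin j) (∈-allFin k))) occ)

  closed⇒Conn-closed : ∀ {S} → All (ClosedUnder S) occurrence-edges → ∀ {v u} → Conn π v u → u ∈ S → v ∈ S
  closed⇒Conn-closed closed here u∈S = u∈S
  closed⇒Conn-closed closed (step (t , occ) v∈o w∈o w~u) u∈S =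
    All.lookup closed (occurrence∈edges occ) (∈ₑ-meets (entries t) w∈o (closed⇒Conn-closed closed w~u u∈S)) v∈o

theorem1 : ∀ (m r : ℕ) (π : Fin (suc m) → Fin (suc m)) → Injective _≡_ _≡_ π →
    occ132 π ≡ r →
    ∀ (ks : List (Fin (suc m))) → Unique ks → All (InKernel π) ks →
    length ks ≤ 2 * r + 1
theorem1 m r π _ occ ks ks-unique ks-kernel = begin
  length ks                           ≤⟨ Unique-⊆⇒length≤ ks-unique ks⊆carrier ⟩
  length carrier                      ≤⟨ size ⟩
  1 + 2 * length (occurrence-edges π) ≡⟨ cong (λ l → 1 + 2 * l) (trans (length-occurrence-edges π) occ) ⟩
  1 + 2 * r                           ≡⟨ +-comm 1 (2 * r) ⟩
  2 * r + 1                           ∎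
  where
    open Hypergraph (Fin._≟_ {suc m})
    open Closure (closure (fromℕ m ∷ []) (occurrence-edges π))
    open ≤-Reasoning

    ks⊆carrier : ks ⊆ carrier
    ks⊆carrier k∈ks = closed⇒Conn-closed π closed (All.lookup ks-kernel k∈ks) (extends (here refl))
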